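{- Let $\tilde x \in \mathbb{Z}_{\geq 0}^{[m]}$ be an integer vector of open slots on the nodes of the tree. Suppose that the inequality $$\sum_{i \in [m]} \min\{|J'(\mathsf{Anc}(i))|, g\} \cdot \tilde x(i) \;\geq\; p(J')$$ holds for every subset $J' \subseteq J$ of jobs satisfying the property $$p_j > \tilde x\Big(\big\{i \in \mathsf{Des}(K(j)) : |J'(\mathsf{Anc}(i))| \leq g\big\}\Big) \quad \text{for all } j \in J'.$$ Then the same inequality holds for every subset $J' \subseteq J$. Consequently, $\tilde x$ is a feasible schedule (all jobs can be scheduled) if and only if the inequality holds for all $J'$ satisfying this property.
   Context: Active time scheduling on a laminar (tree) family of intervals: the nodes of a rooted tree are $[m]$; each node $i$ has an interval length $L(i)$; each job $j \in J$ has a processing time $p_j$ and is associated with a node $K(j)$, and may only be processed in slots of nodes in $\mathsf{Des}(K(j))$ (descendants of $K(j)$, including $K(j)$). Each open slot can process at most $g$ jobs, and a job uses at most one unit per slot. For an integer vector $\tilde x$ (number of open slots per node), $\tilde x$ is feasible if one can assign, for each job $j$, amounts $y(i,j)\ge 0$ to nodes $i\in\mathsf{Des}(K(j))$ with $\sum_i y(i,j)\ge p_j$, $y(i,j)\le \tilde x(i)$ and $\sum_j y(i,j)\le g\,\tilde x(i)$. Notation: $\mathsf{Anc}(i)$ and $\mathsf{Des}(i)$ denote the ancestors and descendants of $i$ (including $i$); $J(S)$ is the set of jobs $j$ with $K(j)\in S$; for $J'\subseteq J$, $J'(S) = J(S)\cap J'$; $p(J')=\sum_{j\in J'}p_j$;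 $\tilde x(S)=\sum_{i\in S}\tilde x(i)$. A previous lemma (proved via max-flow/min-cut) shows that $\tilde x$ is feasible if and only if the displayed inequality holds for every $J' \subseteq J$.
   Formalization: The amounts y(i,j) in the definition of feasibility of $\tilde x$ take values in the rationals. -}

module Defs where

open import Data.Nat using (ℕ; zero; suc; _+_; _*_; _≤_; _<_; _⊓_; _≤?_)
open import Data.Fin using (Fin)
open import Data.Fin.Properties using () renaming (_≟_ to _≟ᶠ_)
open import Data.Fin.Subset using (Subset; _∈_)
open import Data.Fin.Subset.Properties using (_∈?_)
open import Data.Maybe using (Maybe; just; nothing)
open import Data.List using (List; []; _∷_; map; filter; length; allFin; foldr)
open import Data.List.Membership.Propositional using () renaming (_∈_ to _∈ˡ_)
open import Data.List.Relation.Unary.Any using (any?)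
open import Relation.Nullary using (Dec)
open import Data.Nat.ListAction using (sum)
open import Data.Product using (Σ; _×_; ∃)
open import Relation.Nullary using (¬_)
open import Relation.Nullary.Decidable using (_×-dec_)
open import Relation.Binary.PropositionalEquality using (_≡_; _≢_)
open import Data.Integer using (+_)
import Data.Rational as ℚ
open ℚ using (ℚ; 0ℚ)

-- Rooted trees on the node set [m] = Fin m, given by a parent map.
-- Acyclicity is witnessed by a depth function strictly increasing
-- from parent to child; there is exactly one root.

_∈ˡ?_ : ∀ {m} (a : Fin m) (xs : List (Fin m)) → Dec (a ∈ˡ xs)
a ∈ˡ? xs = any? (a ≟ᶠ_) xs

record Tree (m : ℕ) : Set where
  field
    parent      : Fin m → Maybe (Fin m)
    depth       : Fin m → ℕ
    depth-<     : ∀ i k → parent i ≡ just k → depth k < depth i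
    root        : Fin m
    root-parent : parent root ≡ nothing
    nonroot     : ∀ i → i ≢ root → ∃ λ k → parent i ≡ just k

module _ {m : ℕ} (T : Tree m) where
  open Tree T

  ancestorsUpTo : ℕ → Fin m → List (Fin m)
  ancestorsUpTo zero    i = []
  ancestorsUpTo (suc f) i with parent i
  ... | nothing = i ∷ []
  ... | just k  = i ∷ ancestorsUpTo f k

  -- Anc(i), including i.  Since the tree is acyclic, every chain to the
  -- root has at most m nodes, so fuel m gives all ancestors.
  Anc : Fin m → List (Fin m)
  Anc i = ancestorsUpTo m i

  -- a is an ancestor of i (including a = i); equivalently i ∈ Des(a)
  _isAncOf_ : Fin m → Fin m → Set
  a isAncOf i = a ∈ˡ Anc i

record Instance : Set where
  field
    m    : ℕ
    tree : Tree m
    L    : Fin m → ℕ         -- interval lengths (not used by the lemma)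
    n    : ℕ
    p    : Fin n → ℕ
    K    : Fin n → Fin m
    g    : ℕ
    g≥1  : 1 ≤ g

module _ (I : Instance) where
  open Instance I

  Σnodes : (Fin m → ℕ) → ℕ
  Σnodes f = sum (map f (allFin m))

  countAnc : Subset n → Fin m → ℕ
  countAnc J' i =
    length (filter (λ j → (j ∈? J') ×-dec (K j ∈ˡ? Anc tree i)) (allFin n))

  pSum : Subset n → ℕ
  pSum J' = sum (map p (filter (λ j → j ∈? J') (allFin n)))

  lhs : (Fin m → ℕ) → Subset n → ℕ
  lhs x J' = Σnodes (λ i → (countAnc J' i ⊓ g) * x i)

  Ineq : (Fin m → ℕ) → Subset n → Set
  Ineq x J' = pSum J' ≤ lhs x J'

  xSmall : (Fin m → ℕ) → Subset n → Fin n → ℕ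
  xSmall x J' j =
    sum (map x (filter (λ i → (K j ∈ˡ? Anc tree i) ×-dec (countAnc J' i ≤? g))
                       (allFin m)))

  Property : (Fin m → ℕ) → Subset n → Set
  Property x J' = ∀ j → j ∈ J' → xSmall x J' j < p j

  ℕtoℚ : ℕ → ℚ
  ℕtoℚ k = + k ℚ./ 1

  Σℚ : List ℚ → ℚ
  Σℚ = foldr ℚ._+_ 0ℚ

  Feasible : (Fin m → ℕ) → Set
  Feasible x = Σ (Fin m → Fin n → ℚ) λ y →
      (∀ i j → K j isAncOf' i → 0ℚ ℚ.≤ y i j)
    × (∀ i j → K j isAncOf' i → y i j ℚ.≤ ℕtoℚ (x i))
    × (∀ j → ℕtoℚ (p j) ℚ.≤
              Σℚ (map (λ i → y i j)
                      (filter (λ i → K j ∈ˡ? Anc tree i) (allFin m))))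
    × (∀ i → Σℚ (map (λ j → y i j)
                      (filter (λ j → K j ∈ˡ? Anc tree i) (allFin n)))
              ℚ.≤ ℕtoℚ (g * x i))
    where
      _isAncOf'_ : Fin m → Fin m → Set
      a isAncOf' i = _isAncOf_ tree a i

module Submission where

open import Level using (0ℓ)
open import Algebra.Bundles using (CommutativeMonoid)
import Algebra.Properties.CommutativeMonoid.Sum as MonoidSum
open import Data.Bool using (Bool; true; false; _∧_; _∨_; if_then_else_)
open import Data.Empty using (⊥; ⊥-elim)
open import Data.Fin using (Fin; zero; suc)
import Data.Fin.Properties as Fin
open import Data.Fin.Subset using (Subset; _∈_; _∪_; _∩_) renaming (⊥ to ∅)
open import Data.Fin.Subset.Properties using (_∈?_; ∪-comm; anySubset?)
import Data.Integer as ℤ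
import Data.Integer.Properties as ℤ
open import Data.List using ([]; _∷_; map; filter; length; foldr; allFin; tabulate)
open import Data.List.Membership.Propositional using () renaming (_∈_ to _∈ˡ_)
open import Data.List.Properties using (map-tabulate)
open import Data.Nat as ℕ using (ℕ; zero; suc; _+_; _*_; _≤_; _<_; _⊓_; _≤?_; z≤n; s≤s)
import Data.Nat.Coprimality as Coprime
open import Data.Nat.Induction using (<-wellFounded)
open import Data.Nat.Properties
open import Data.Nat.Solver using (module +-*-Solver)
open import Algebra.Properties.Semiring.Sum +-*-semiring using (*-distribʳ-sum)
open import Data.Product using (∃; ∃-syntax; _×_; _,_; proj₁; proj₂)
open import Data.Rational as ℚ using (ℚ; 0ℚ; mkℚ)
import Data.Rational.Properties as ℚ
open import Data.Sum using (_⊎_; inj₁; inj₂)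
open import Data.Vec using (_∷_; lookup; _[_]≔_)
open import Data.Vec.Functional using (updateAt)
open import Data.Vec.Functional.Properties using (updateAt-updates; updateAt-minimal)
import Data.Vec.Properties as Vec
open import Function using (_∘_)
open import Function.Bundles using (_⇔_; mk⇔; module Equivalence)
open import Induction.WellFounded using (Acc; acc)
open import Relation.Binary.PropositionalEquality
open import Relation.Nullary using (¬_; ¬?; Dec; yes; no; does; contradiction)
open import Relation.Nullary.Decidable using (decidable-stable; dec-true)
open import Relation.Unary using (Decidable)

open import Defs

open +-*-Solver using (solve; _:+_; _:=_)

-- Reduction to the property.  If j ∈ J′ violates it, i.e. p_j ≤ x̃(D) where D is the set of nodes
-- i ∈ Des(K(j)) with |J′(Anc(i))| ≤ g, then removing j from J′ lowers p(J′) by p_j but the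
-- left-hand side by at least x̃(D): for i ∈ D the term min{|J′(Anc(i))|, g}·x̃(i) drops by x̃(i), and
-- no term grows.  So the inequality for J′ − j implies the one for J′, and induction on |J′| reduces
-- every J′ to one with the property.
--
-- Feasibility.  This is a transportation problem: node i sends at most x̃(i) units to each job j
-- with i ∈ Des(K(j)) and at most g·x̃(i) units in total, and job j needs p_j units.  The inequality
-- for J′ is its cut condition  p(J′) ≤ Σ_i min{capacity from i into J′, g·x̃(i)},  which any
-- fractional schedule satisfies by summation.  Conversely an integral flow is built by induction on
-- the total demand: route one unit of a positive p_j through a node i such that lowering p_j, the
-- capacity of (i, j) and the supply of i by one preserves the cut condition.  If no node qualifies,
-- each node is useless for j or saturated by a tight set avoiding j.  Such tight sets are closed
-- under union (the cut function is submodular and demand is modular), and adding j to the union of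
-- all of them raises the demand by p_j but not the cut, contradicting the cut condition.

module WeightedSums (M : CommutativeMonoid 0ℓ 0ℓ) where
  open CommutativeMonoid M using (Carrier; _≈_; _∙_; ε; ∙-congˡ; identityˡ)
  private module ≈ = CommutativeMonoid M
  open MonoidSum M public using (sum; sum-cong-≗; ∑-comm; ∑-distrib-+; sum-replicate-zero)

  when : Bool → Carrier → Carrier
  when b v = if b then v else ε

  sumOver : ∀ {n} → Subset n → (Fin n → Carrier) → Carrier
  sumOver S v = sum (λ j → when (lookup S j) (v j))

  when-sum : ∀ {n} b (f : Fin n → Carrier) → when b (sum f) ≈ sum (λ i → when b (f i))
  when-sum     true  f = ≈.refl
  when-sum {n} false f = ≈.sym (sum-replicate-zero n)

  foldr-map-filter : ∀ {A : Set} {P : A → Set} (P? : Decidable P) (f : A → Carrier) xs →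
    foldr _∙_ ε (map f (filter P? xs)) ≈ foldr _∙_ ε (map (λ a → when (does (P? a)) (f a)) xs)
  foldr-map-filter P? f []       = ≈.refl
  foldr-map-filter P? f (a ∷ xs) with does (P? a)
  ... | true  = ∙-congˡ (foldr-map-filter P? f xs)
  ... | false = ≈.trans (foldr-map-filter P? f xs) (≈.sym (identityˡ _))

  foldr-map-allFin : ∀ {n} (f : Fin n → Carrier) → foldr _∙_ ε (map f (allFin n)) ≈ sum f
  foldr-map-allFin {n} f =
    ≈.trans (≈.reflexive (cong (foldr _∙_ ε) (map-tabulate {n = n} (λ i → i) f))) (foldr-tabulate f)
    where
    foldr-tabulate : ∀ {n} (f : Fin n → Carrier) → foldr _∙_ ε (tabulate f) ≈ sum f
    foldr-tabulate {zero}  f = ≈.refl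
    foldr-tabulate {suc n} f = ∙-congˡ (foldr-tabulate (λ i → f (suc i)))

open WeightedSums +-0-commutativeMonoid

sum-mono-≤ : ∀ {n} {f g : Fin n → ℕ} → (∀ i → f i ≤ g i) → sum f ≤ sum g
sum-mono-≤ {zero}  f≤g = z≤n
sum-mono-≤ {suc n} f≤g = +-mono-≤ (f≤g zero) (sum-mono-≤ (f≤g ∘ suc))

sum-exchange : ∀ {n} (a : Fin n) (f g : Fin n → ℕ) → (∀ i → i ≢ a → f i ≡ g i) →
               sum f + g a ≡ sum g + f a
sum-exchange zero f g f≗g = begin
  f zero + sum (f ∘ suc) + g zero  ≡⟨ cong (λ s → f zero + s + g zero)
                                             (sum-cong-≗ λ i → f≗g (suc i) λ ()) ⟩
  f zero + sum (g ∘ suc) + g zero  ≡⟨ solve 3 (λ a s b → a :+ s :+ b := b :+ s :+ a) refl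
                                              (f zero) (sum (g ∘ suc)) (g zero) ⟩
  g zero + sum (g ∘ suc) + f zero  ∎
  where open ≡-Reasoning
sum-exchange (suc a) f g f≗g = begin
  f zero + sum (f ∘ suc) + g (suc a)    ≡⟨ +-assoc (f zero) _ _ ⟩
  f zero + (sum (f ∘ suc) + g (suc a))  ≡⟨ cong₂ _+_ (f≗g zero λ ()) (sum-exchange a (f ∘ suc) (g ∘ suc)
                                             λ i i≢a → f≗g (suc i) (i≢a ∘ Fin.suc-injective)) ⟩
  g zero + (sum (g ∘ suc) + f (suc a))  ≡⟨ +-assoc (g zero) _ _ ⟨
  g zero + sum (g ∘ suc) + f (suc a)    ∎
  where open ≡-Reasoning

sum-≡0 : ∀ {n} (f : Fin n → ℕ) → sum f ≡ 0 → ∀ i → f i ≡ 0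
sum-≡0 f sum≡0 zero    = m+n≡0⇒m≡0 (f zero) sum≡0
sum-≡0 f sum≡0 (suc i) = sum-≡0 (f ∘ suc) (m+n≡0⇒n≡0 (f zero) sum≡0) i

sum-suc : ∀ {n} (f : Fin n → ℕ) {k} → sum f ≡ suc k → ∃[ i ] ∃[ q ] f i ≡ suc q
sum-suc {suc n} f sum≡1+k with f zero in f₀≡
... | suc q = zero , q , f₀≡
... | zero  with sum-suc (f ∘ suc) sum≡1+k
...   | i , q , fi≡ = suc i , q , fi≡

sum-updateAt : ∀ {n} (v : Fin n → ℕ) i f → sum (updateAt v i f) + v i ≡ sum v + f (v i)
sum-updateAt v i f = trans (sum-exchange i (updateAt v i f) v (λ k k≢i → updateAt-minimal k i v k≢i))
                           (cong (sum v +_) (updateAt-updates i v))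

sum-updateAt-suc : ∀ {n} (v : Fin n → ℕ) i → sum (updateAt v i suc) ≡ suc (sum v)
sum-updateAt-suc v i = +-cancelʳ-≡ (v i) _ _ (trans (sum-updateAt v i suc) (+-suc (sum v) (v i)))

sum-updateAt-pred : ∀ {n} (v : Fin n → ℕ) i {a} → v i ≡ suc a → sum v ≡ suc (sum (updateAt v i ℕ.pred))
sum-updateAt-pred v i {a} vi≡1+a = +-cancelʳ-≡ a _ _ (begin
  sum v + a                            ≡⟨ cong (λ t → sum v + ℕ.pred t) vi≡1+a ⟨
  sum v + ℕ.pred (v i)                 ≡⟨ sum-updateAt v i ℕ.pred ⟨
  sum (updateAt v i ℕ.pred) + v i      ≡⟨ cong (sum (updateAt v i ℕ.pred) +_) vi≡1+a ⟩
  sum (updateAt v i ℕ.pred) + suc a    ≡⟨ +-suc _ a ⟩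
  suc (sum (updateAt v i ℕ.pred)) + a  ∎)
  where open ≡-Reasoning

updateAt-suc-≤ : ∀ {n} {x y : Fin n → ℕ} i {a} → y i ≡ suc a →
                 (∀ l → x l ≤ updateAt y i ℕ.pred l) → ∀ l → updateAt x i suc l ≤ y l
updateAt-suc-≤ {x = x} {y} i yi≡1+a x≤y⁻ l with l Fin.≟ i
... | yes refl = subst₂ _≤_ (sym (updateAt-updates i x)) (sym yi≡1+a)
                   (s≤s (subst (x i ≤_) (trans (updateAt-updates i y) (cong ℕ.pred yi≡1+a)) (x≤y⁻ i)))
... | no l≢i   = subst₂ _≤_ (sym (updateAt-minimal l i x l≢i)) (updateAt-minimal l i y l≢i) (x≤y⁻ l)

updateAt-pred-≤ : ∀ {n} {x y : Fin n → ℕ} i {a} → y i ≡ suc a →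
                  (∀ l → updateAt y i ℕ.pred l ≤ x l) → ∀ l → y l ≤ updateAt x i suc l
updateAt-pred-≤ {x = x} {y} i yi≡1+a y⁻≤x l with l Fin.≟ i
... | yes refl = subst₂ _≤_ (sym yi≡1+a) (sym (updateAt-updates i x))
                   (s≤s (subst (_≤ x i) (trans (updateAt-updates i y) (cong ℕ.pred yi≡1+a)) (y⁻≤x i)))
... | no l≢i   = subst₂ _≤_ (updateAt-minimal l i y l≢i) (sym (updateAt-minimal l i x l≢i)) (y⁻≤x l)

updateAt₂ : ∀ {m n} {A : Set} → (Fin m → Fin n → A) → Fin m → Fin n → (A → A) → Fin m → Fin n → A
updateAt₂ y i j f = updateAt y i (λ row → updateAt row j f)

module _ {m n : ℕ} (y : Fin m → Fin n → ℕ) (i : Fin m) (j : Fin n) where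

  sum-updateAt₂-row : ∀ k → sum (updateAt₂ y i j suc k) ≡ updateAt (λ k → sum (y k)) i suc k
  sum-updateAt₂-row k with k Fin.≟ i
  ... | yes refl = trans (cong sum (updateAt-updates i y))
                         (trans (sum-updateAt-suc (y i) j) (sym (updateAt-updates i (λ k → sum (y k)))))
  ... | no k≢i   = trans (cong sum (updateAt-minimal k i y k≢i)) (sym (updateAt-minimal k i _ k≢i))

  sum-updateAt₂-column : ∀ l → sum (λ k → updateAt₂ y i j suc k l)
                                ≡ updateAt (λ l → sum (λ k → y k l)) j suc l
  sum-updateAt₂-column l with l Fin.≟ j
  ... | yes refl = trans (sum-cong-≗ column-j)
                         (trans (sum-updateAt-suc (λ k → y k j) i) (sym (updateAt-updates j _)))
    where
    column-j : ∀ k → updateAt₂ y i j suc k j ≡ updateAt (λ k → y k j) i suc k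
    column-j k with k Fin.≟ i
    ... | yes refl = trans (cong (λ row → row j) (updateAt-updates i y))
                           (trans (updateAt-updates j (y i)) (sym (updateAt-updates i (λ k → y k j))))
    ... | no k≢i   = trans (cong (λ row → row j) (updateAt-minimal k i y k≢i))
                           (sym (updateAt-minimal k i (λ k → y k j) k≢i))
  ... | no l≢j   = trans (sum-cong-≗ other-column) (sym (updateAt-minimal l j _ l≢j))
    where
    other-column : ∀ k → updateAt₂ y i j suc k l ≡ y k l
    other-column k with k Fin.≟ i
    ... | yes refl = trans (cong (λ row → row l) (updateAt-updates i y)) (updateAt-minimal l j (y i) l≢j)
    ... | no k≢i   = cong (λ row → row l) (updateAt-minimal k i y k≢i)

  updateAt₂-suc-≤ : ∀ {u : Fin m → Fin n → ℕ} {a} → u i j ≡ suc a →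
                    (∀ k l → y k l ≤ updateAt₂ u i j ℕ.pred k l) → ∀ k l → updateAt₂ y i j suc k l ≤ u k l
  updateAt₂-suc-≤ {u} uij≡1+a y≤u⁻ k l with k Fin.≟ i
  ... | yes refl = subst (_≤ u i l) (sym (cong (λ row → row l) (updateAt-updates i y)))
                     (updateAt-suc-≤ j uij≡1+a (λ l → subst (λ row → y i l ≤ row l) (updateAt-updates i u)
                                                            (y≤u⁻ i l)) l)
  ... | no k≢i   = subst₂ _≤_ (sym (cong (λ row → row l) (updateAt-minimal k i y k≢i)))
                     (cong (λ row → row l) (updateAt-minimal k i u k≢i)) (y≤u⁻ k l)

when-cancel : ∀ b x y a → x + when b (suc a) ≡ y + when b a → y ≡ when b 1 + x
when-cancel true  x y a eq = sym (+-cancelʳ-≡ a (suc x) y (trans (sym (+-suc x a)) eq))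
when-cancel false x y a eq = sym (+-cancelʳ-≡ 0 x y eq)

when-∨-∧ : ∀ a b v → when (a ∨ b) v + when (a ∧ b) v ≡ when a v + when b v
when-∨-∧ true  true  v = refl
when-∨-∧ true  false v = refl
when-∨-∧ false true  v = +-comm v 0
when-∨-∧ false false v = refl

when-∧-≤ : ∀ a b v → when (a ∧ b) v ≤ when a v
when-∧-≤ true  true  v = ≤-refl
when-∧-≤ true  false v = z≤n
when-∧-≤ false b     v = z≤n

when-≤-∨ : ∀ a b v → when a v ≤ when (a ∨ b) v
when-≤-∨ true  b v = ≤-refl
when-≤-∨ false b v = z≤n

when-∧ : ∀ a b v → when (a ∧ b) v ≡ when a (when b v)
when-∧ true  b v = refl
when-∧ false b v = refl

when-when-* : ∀ a b v → when a (when b v) ≡ when a (when b 1) * v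
when-when-* true  true  v = sym (*-identityˡ v)
when-when-* true  false v = refl
when-when-* false b     v = refl

when-fixes : ∀ b {v w} → v ≤ when b w → when b v ≡ v
when-fixes true  v≤w = refl
when-fixes false v≤0 = sym (n≤0⇒n≡0 v≤0)

module _ {n : ℕ} where

  sumOver-∪-∩ : ∀ (T S : Subset n) v → sumOver (T ∪ S) v + sumOver (T ∩ S) v ≡ sumOver T v + sumOver S v
  sumOver-∪-∩ T S v = begin
    sumOver (T ∪ S) v + sumOver (T ∩ S) v
      ≡⟨ ∑-distrib-+ (λ j → when (lookup (T ∪ S) j) (v j)) (λ j → when (lookup (T ∩ S) j) (v j)) ⟨
    sum (λ j → when (lookup (T ∪ S) j) (v j) + when (lookup (T ∩ S) j) (v j))
      ≡⟨ sum-cong-≗ pointwise ⟩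
    sum (λ j → when (lookup T j) (v j) + when (lookup S j) (v j))
      ≡⟨ ∑-distrib-+ (λ j → when (lookup T j) (v j)) (λ j → when (lookup S j) (v j)) ⟩
    sumOver T v + sumOver S v ∎
    where
    open ≡-Reasoning
    pointwise : ∀ j → when (lookup (T ∪ S) j) (v j) + when (lookup (T ∩ S) j) (v j)
                    ≡ when (lookup T j) (v j) + when (lookup S j) (v j)
    pointwise j rewrite Vec.lookup-zipWith _∨_ j T S | Vec.lookup-zipWith _∧_ j T S =
      when-∨-∧ (lookup T j) (lookup S j) (v j)

  sumOver-∩-≤ : ∀ (T S : Subset n) v → sumOver (T ∩ S) v ≤ sumOver T v
  sumOver-∩-≤ T S v = sum-mono-≤ λ j → subst (λ b → when b (v j) ≤ _) (sym (Vec.lookup-zipWith _∧_ j T S))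
                                              (when-∧-≤ (lookup T j) (lookup S j) (v j))

  sumOver-≤-∪ : ∀ (T S : Subset n) v → sumOver T v ≤ sumOver (T ∪ S) v
  sumOver-≤-∪ T S v = sum-mono-≤ λ j → subst (λ b → _ ≤ when b (v j)) (sym (Vec.lookup-zipWith _∨_ j T S))
                                              (when-≤-∨ (lookup T j) (lookup S j) (v j))

  sumOver-∅ : ∀ (v : Fin n → ℕ) → sumOver ∅ v ≡ 0
  sumOver-∅ v = trans (sum-cong-≗ (λ j → cong (λ b → when b (v j)) (Vec.lookup-replicate j false)))
                      (sum-replicate-zero n)

  sumOver-update : ∀ (T : Subset n) j b v →
                   sumOver (T [ j ]≔ b) v + when (lookup T j) (v j) ≡ sumOver T v + when b (v j)
  sumOver-update T j b v =
    subst (λ b′ → sumOver (T [ j ]≔ b) v + _ ≡ _ + when b′ (v j)) (Vec.lookup∘update j T b)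
      (sum-exchange j (λ k → when (lookup (T [ j ]≔ b) k) (v k)) (λ k → when (lookup T k) (v k))
         λ k k≢j → cong (λ b′ → when b′ (v k)) (Vec.lookup∘update′ k≢j T b))

  sumOver-insert : ∀ (T : Subset n) j v → lookup T j ≡ false → sumOver (T [ j ]≔ true) v ≡ sumOver T v + v j
  sumOver-insert T j v j∉T = trans (sym (+-identityʳ _))
    (subst (λ b → sumOver (T [ j ]≔ true) v + when b (v j) ≡ sumOver T v + v j) j∉T (sumOver-update T j true v))

  sumOver-remove : ∀ (T : Subset n) j v → lookup T j ≡ true → sumOver T v ≡ v j + sumOver (T [ j ]≔ false) v
  sumOver-remove T j v j∈T = trans (sym (+-identityʳ _)) (sym (trans (+-comm (v j) _)
    (subst (λ b → sumOver (T [ j ]≔ false) v + when b (v j) ≡ sumOver T v + 0) j∈T (sumOver-update T j false v))))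

  sumOver-pred : ∀ (S : Subset n) (v : Fin n → ℕ) j {a} → v j ≡ suc a →
                 sumOver S v ≡ when (lookup S j) 1 + sumOver S (updateAt v j ℕ.pred)
  sumOver-pred S v j {a} vj≡1+a = when-cancel (lookup S j) _ _ a (begin
    sumOver S v⁻ + when (lookup S j) (suc a)        ≡⟨ cong (λ t → sumOver S v⁻ + when (lookup S j) t) vj≡1+a ⟨
    sumOver S v⁻ + when (lookup S j) (v j)          ≡⟨ sum-exchange j _ _ (λ k k≢j →
                                                         cong (when (lookup S k)) (updateAt-minimal k j v k≢j)) ⟩
    sumOver S v + when (lookup S j) (v⁻ j)          ≡⟨ cong (λ t → sumOver S v + when (lookup S j) t)
                                                         (trans (updateAt-updates j v) (cong ℕ.pred vj≡1+a)) ⟩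
    sumOver S v + when (lookup S j) a               ∎)
    where
    open ≡-Reasoning
    v⁻ : Fin n → ℕ
    v⁻ = updateAt v j ℕ.pred

removal-induction : ∀ {n} (P : Subset n → Set) →
                    (∀ J → P J ⊎ ∃[ j ] lookup J j ≡ true × (P (J [ j ]≔ false) → P J)) → ∀ J → P J
removal-induction P step J = go J (<-wellFounded (sumOver J (λ _ → 1)))
  where
  go : ∀ J → Acc _<_ (sumOver J (λ _ → 1)) → P J
  go J (acc smaller) with step J
  ... | inj₁ PJ                  = PJ
  ... | inj₂ (j , j∈J , extend) =
    extend (go (J [ j ]≔ false) (smaller (≤-reflexive (sym (sumOver-remove J j (λ _ → 1) j∈J)))))

⊓-concave : ∀ a b c d k → a + b ≡ c + d → d ≤ a → a ≤ c → c ⊓ k + d ⊓ k ≤ a ⊓ k + b ⊓ k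
⊓-concave a b c d k a+b≡c+d d≤a a≤c with k ≤? a | k ≤? b
... | yes k≤a | _ = +-mono-≤ (≤-trans (m⊓n≤n c k) (≤-reflexive (sym (m≥n⇒m⊓n≡n k≤a)))) (⊓-monoˡ-≤ k d≤b)
  where
  d≤b : d ≤ b
  d≤b = +-cancelˡ-≤ c d b (≤-trans (≤-reflexive (sym a+b≡c+d)) (+-monoˡ-≤ b a≤c))
... | no _ | yes k≤b =
  ≤-trans (+-mono-≤ (≤-trans (m⊓n≤n c k) (≤-reflexive (sym (m≥n⇒m⊓n≡n k≤b)))) (⊓-monoˡ-≤ k d≤a))
          (≤-reflexive (+-comm (b ⊓ k) (a ⊓ k)))
... | no a≱k | no b≱k = begin
  c ⊓ k + d ⊓ k  ≤⟨ +-mono-≤ (m⊓n≤m c k) (m⊓n≤m d k) ⟩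
  c + d          ≡⟨ a+b≡c+d ⟨
  a + b          ≡⟨ cong₂ _+_ (m≤n⇒m⊓n≡m (<⇒≤ (≰⇒> a≱k))) (m≤n⇒m⊓n≡m (<⇒≤ (≰⇒> b≱k))) ⟨
  a ⊓ k + b ⊓ k  ∎
  where open ≤-Reasoning

⊓-absorbs-+ : ∀ s x k → k ≤ s ⊎ x ≡ 0 ⊎ k ≡ 0 → (s + x) ⊓ k ≡ s ⊓ k
⊓-absorbs-+ s x k (inj₁ k≤s)         = trans (m≥n⇒m⊓n≡n (≤-trans k≤s (m≤m+n s x))) (sym (m≥n⇒m⊓n≡n k≤s))
⊓-absorbs-+ s x k (inj₂ (inj₁ refl)) = cong (_⊓ k) (+-identityʳ s)
⊓-absorbs-+ s x k (inj₂ (inj₂ refl)) = trans (⊓-zeroʳ (s + x)) (sym (⊓-zeroʳ s))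

-- The demand p of a set of jobs, the capacity s from a node into it and its cut value k, against the
-- same quantities p⁻, s⁻, k⁻ after routing one unit from that node (of supply suc c) to a job; b says
-- whether the job is in the set.
blocking-arith : ∀ b {p p⁻ s s⁻ c k k⁻} → p ≡ when b 1 + p⁻ → s ≡ when b 1 + s⁻ →
                 k⁻ + s ⊓ suc c ≡ k + s⁻ ⊓ c → p ≤ k → k⁻ < p⁻ → b ≡ false × k ≤ p × suc c ≤ s
blocking-arith true {p⁻ = p⁻} {s⁻ = s⁻} {c} {k} {k⁻} refl refl cut≡ p≤k k⁻<p⁻ =
  contradiction (≤-trans p≤k (≤-reflexive k≡1+k⁻)) (<⇒≱ (s≤s k⁻<p⁻))
  where
  k≡1+k⁻ : k ≡ suc k⁻
  k≡1+k⁻ = +-cancelʳ-≡ (s⁻ ⊓ c) k (suc k⁻) (sym (trans (sym (+-suc k⁻ (s⁻ ⊓ c))) cut≡))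
blocking-arith false {p⁻ = p⁻} {s = s} {c = c} {k} {k⁻} refl refl cut≡ p≤k k⁻<p⁻ with suc c ≤? s
... | yes 1+c≤s = refl , ≤-trans (≤-reflexive k≡1+k⁻) k⁻<p⁻ , 1+c≤s
  where
  k≡1+k⁻ : k ≡ suc k⁻
  k≡1+k⁻ = +-cancelʳ-≡ c k (suc k⁻) (sym (begin
    suc k⁻ + c      ≡⟨ +-suc k⁻ c ⟨
    k⁻ + suc c      ≡⟨ cong (k⁻ +_) (m≥n⇒m⊓n≡n 1+c≤s) ⟨
    k⁻ + s ⊓ suc c  ≡⟨ cut≡ ⟩
    k + s ⊓ c       ≡⟨ cong (k +_) (m≥n⇒m⊓n≡n (<⇒≤ 1+c≤s)) ⟩
    k + c           ∎))
    where open ≡-Reasoning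
... | no 1+c≰s = contradiction (≤-trans k⁻<p⁻ (≤-trans p≤k (≤-reflexive k≡k⁻))) (<-irrefl refl)
  where
  s≤c : s ≤ c
  s≤c = ≤-pred (≰⇒> 1+c≰s)
  k≡k⁻ : k ≡ k⁻
  k≡k⁻ = +-cancelʳ-≡ s k k⁻ (sym (begin
    k⁻ + s          ≡⟨ cong (k⁻ +_) (m≤n⇒m⊓n≡m (m≤n⇒m≤1+n s≤c)) ⟨
    k⁻ + s ⊓ suc c  ≡⟨ cut≡ ⟩
    k + s ⊓ c       ≡⟨ cong (k +_) (m≤n⇒m⊓n≡m s≤c) ⟩
    k + s           ∎))
    where open ≡-Reasoning

⊓-increment : ∀ g b {c c′} x → c′ ≡ when b 1 + c →
              when (b ∧ does (c′ ≤? g)) x + (c ⊓ g) * x ≤ (c′ ⊓ g) * x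
⊓-increment g false x refl = ≤-refl
⊓-increment g true {c} x refl = increment (suc c ≤? g)
  where
  increment : (d : Dec (suc c ≤ g)) → when (does d) x + (c ⊓ g) * x ≤ (suc c ⊓ g) * x
  increment (yes 1+c≤g) = ≤-reflexive (trans (cong (λ t → x + t * x) (m≤n⇒m⊓n≡m (<⇒≤ 1+c≤g)))
                                             (cong (_* x) (sym (m≤n⇒m⊓n≡m 1+c≤g))))
  increment (no _)      = *-monoˡ-≤ x (⊓-monoˡ-≤ g (n≤1+n c))

∃-or-∀ : ∀ {n} {A B : Fin n → Set} → (∀ i → A i ⊎ B i) → ∃ A ⊎ (∀ i → B i)
∃-or-∀ {zero}  choice = inj₂ λ ()
∃-or-∀ {suc n} choice with choice zero | ∃-or-∀ (choice ∘ suc)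
... | inj₁ a | _            = inj₁ (zero , a)
... | inj₂ _ | inj₁ (i , a) = inj₁ (suc i , a)
... | inj₂ b | inj₂ bs      = inj₂ λ { zero → b ; (suc i) → bs i }

union-closure : ∀ {m n} {P : Subset n → Set} {Q : Subset n → Fin m → Set} →
                P ∅ → (∀ T S → P T → P S → P (T ∪ S)) → (∀ T S {i} → Q T i → Q (T ∪ S) i) →
                (∀ i → ∃[ S ] P S × Q S i) → ∃[ T ] P T × (∀ i → Q T i)
union-closure {zero}  P∅ _ _ _ = ∅ , P∅ , λ ()
union-closure {suc m} {P = P} {Q} P∅ P-∪ Q-∪ witnesses
  with witnesses zero | union-closure {Q = λ S i → Q S (suc i)} P∅ P-∪ (λ T S → Q-∪ T S) (witnesses ∘ suc)
... | S , PS , QS₀ | T , PT , QT = S ∪ T , P-∪ S T PS PT , λ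
  { zero    → Q-∪ S T QS₀
  ; (suc i) → subst (λ U → Q U (suc i)) (∪-comm T S) (Q-∪ T S (QT i)) }

counterexample-or-all : ∀ {n} {P : Subset n → Set} → Decidable P → ∃[ S ] ¬ P S ⊎ (∀ S → P S)
counterexample-or-all P? with anySubset? (¬? ∘ P?)
... | yes counterexample = inj₁ counterexample
... | no  none           = inj₂ λ S → decidable-stable (P? S) (λ ¬PS → none (S , ¬PS))

-- Definitionally equal to ℕtoℚ I, the embedding used by Feasible.
toℚ : ℕ → ℚ
toℚ k = ℤ.+ k ℚ./ 1

toℚ≡mkℚ : ∀ k → toℚ k ≡ mkℚ (ℤ.+ k) 0 (Coprime.sym (Coprime.1-coprimeTo k))
toℚ≡mkℚ k = ℚ.normalize-coprime (Coprime.sym (Coprime.1-coprimeTo k))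

toℚ-mono-≤ : ∀ {a b} → a ≤ b → toℚ a ℚ.≤ toℚ b
toℚ-mono-≤ {a} {b} a≤b rewrite toℚ≡mkℚ a | toℚ≡mkℚ b =
  ℚ.*≤* (subst₂ ℤ._≤_ (sym (ℤ.*-identityʳ (ℤ.+ a))) (sym (ℤ.*-identityʳ (ℤ.+ b))) (ℤ.+≤+ a≤b))

toℚ-cancel-≤ : ∀ {a b} → toℚ a ℚ.≤ toℚ b → a ≤ b
toℚ-cancel-≤ {a} {b} a≤b rewrite toℚ≡mkℚ a | toℚ≡mkℚ b with a≤b
... | ℚ.*≤* a*1≤b*1 with subst₂ ℤ._≤_ (ℤ.*-identityʳ (ℤ.+ a)) (ℤ.*-identityʳ (ℤ.+ b)) a*1≤b*1
...   | ℤ.+≤+ a≤b′ = a≤b′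

toℚ-+ : ∀ a b → toℚ (a + b) ≡ toℚ a ℚ.+ toℚ b
toℚ-+ a b rewrite toℚ≡mkℚ a | toℚ≡mkℚ b =
  ℚ./-cong (sym (cong₂ ℤ._+_ (ℤ.*-identityʳ (ℤ.+ a)) (ℤ.*-identityʳ (ℤ.+ b)))) refl

module ℚΣ = WeightedSums ℚ.+-0-commutativeMonoid

ℚΣ-mono-≤ : ∀ {n} {f g : Fin n → ℚ} → (∀ i → f i ℚ.≤ g i) → ℚΣ.sum f ℚ.≤ ℚΣ.sum g
ℚΣ-mono-≤ {zero}  f≤g = ℚ.≤-refl
ℚΣ-mono-≤ {suc n} f≤g = ℚ.+-mono-≤ (f≤g zero) (ℚΣ-mono-≤ (f≤g ∘ suc))

ℚwhen-mono-≤ : ∀ b {v w} → v ℚ.≤ w → ℚΣ.when b v ℚ.≤ ℚΣ.when b w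
ℚwhen-mono-≤ true  v≤w = v≤w
ℚwhen-mono-≤ false v≤w = ℚ.≤-refl

ℚwhen-≤ : ∀ b {v} → 0ℚ ℚ.≤ v → ℚΣ.when b v ℚ.≤ v
ℚwhen-≤ true  0≤v = ℚ.≤-refl
ℚwhen-≤ false 0≤v = 0≤v

toℚ-when : ∀ b v → toℚ (when b v) ≡ ℚΣ.when b (toℚ v)
toℚ-when true  v = refl
toℚ-when false v = refl

toℚ-sum : ∀ {n} (f : Fin n → ℕ) → toℚ (sum f) ≡ ℚΣ.sum (toℚ ∘ f)
toℚ-sum {zero}  f = refl
toℚ-sum {suc n} f = trans (toℚ-+ (f zero) _) (cong (toℚ (f zero) ℚ.+_) (toℚ-sum (f ∘ suc)))

toℚ-sumOver : ∀ {n} (S : Subset n) v → toℚ (sumOver S v) ≡ ℚΣ.sumOver S (toℚ ∘ v)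
toℚ-sumOver S v = trans (toℚ-sum (λ j → when (lookup S j) (v j)))
                        (ℚΣ.sum-cong-≗ λ j → toℚ-when (lookup S j) (v j))

≤-toℚ-⊓ : ∀ {q} a b → q ℚ.≤ toℚ a → q ℚ.≤ toℚ b → q ℚ.≤ toℚ (a ⊓ b)
≤-toℚ-⊓ a b q≤a q≤b with ⊓-sel a b
... | inj₁ a⊓b≡a = subst (λ t → _ ℚ.≤ toℚ t) (sym a⊓b≡a) q≤a
... | inj₂ a⊓b≡b = subst (λ t → _ ℚ.≤ toℚ t) (sym a⊓b≡b) q≤b

-- u i j bounds the flow from node i to job j, C i the total flow out of node i, and p j is the
-- demand of job j.
module Transportation {m n : ℕ} where

  capacityInto : (Fin m → Fin n → ℕ) → Subset n → Fin m → ℕ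
  capacityInto u S i = sumOver S (u i)

  cut : (Fin m → Fin n → ℕ) → (Fin m → ℕ) → Subset n → ℕ
  cut u C S = sum (λ i → capacityInto u S i ⊓ C i)

  CutCondition : (Fin m → Fin n → ℕ) → (Fin m → ℕ) → (Fin n → ℕ) → Set
  CutCondition u C p = ∀ S → sumOver S p ≤ cut u C S

  record Transport (u : Fin m → Fin n → ℕ) (C : Fin m → ℕ) (p : Fin n → ℕ) : Set where
    field
      flow             : Fin m → Fin n → ℕ
      flow≤capacity    : ∀ i j → flow i j ≤ u i j
      demand-met       : ∀ j → p j ≤ sum (λ i → flow i j)
      supply-respected : ∀ i → sum (flow i) ≤ C i

  cut-submodular : ∀ u C (T S : Subset n) → cut u C (T ∪ S) + cut u C (T ∩ S) ≤ cut u C T + cut u C S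
  cut-submodular u C T S = begin
    cut u C (T ∪ S) + cut u C (T ∩ S)
      ≡⟨ ∑-distrib-+ (λ i → into (T ∪ S) i ⊓ C i) (λ i → into (T ∩ S) i ⊓ C i) ⟨
    sum (λ i → into (T ∪ S) i ⊓ C i + into (T ∩ S) i ⊓ C i)
      ≤⟨ sum-mono-≤ (λ i → ⊓-concave _ _ _ _ (C i) (sym (sumOver-∪-∩ T S (u i)))
                             (sumOver-∩-≤ T S (u i)) (sumOver-≤-∪ T S (u i))) ⟩
    sum (λ i → into T i ⊓ C i + into S i ⊓ C i)
      ≡⟨ ∑-distrib-+ (λ i → into T i ⊓ C i) (λ i → into S i ⊓ C i) ⟩
    cut u C T + cut u C S ∎
    where
    open ≤-Reasoning
    into : Subset n → Fin m → ℕ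
    into = capacityInto u

  fractional-transport⇒cut-condition :
    ∀ u C p (y : Fin m → Fin n → ℚ) →
    (∀ i j → 0ℚ ℚ.≤ y i j) → (∀ i j → y i j ℚ.≤ toℚ (u i j)) →
    (∀ j → toℚ (p j) ℚ.≤ ℚΣ.sum (λ i → y i j)) → (∀ i → ℚΣ.sum (y i) ℚ.≤ toℚ (C i)) →
    CutCondition u C p
  fractional-transport⇒cut-condition u C p y 0≤y y≤u demand y≤C S = toℚ-cancel-≤ (begin
    toℚ (sumOver S p)
      ≡⟨ toℚ-sumOver S p ⟩
    ℚΣ.sumOver S (toℚ ∘ p)
      ≤⟨ ℚΣ-mono-≤ (λ j → ℚwhen-mono-≤ (lookup S j) (demand j)) ⟩
    ℚΣ.sum (λ j → ℚΣ.when (lookup S j) (ℚΣ.sum (λ i → y i j)))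
      ≡⟨ ℚΣ.sum-cong-≗ (λ j → ℚΣ.when-sum (lookup S j) (λ i → y i j)) ⟩
    ℚΣ.sum (λ j → ℚΣ.sum (λ i → ℚΣ.when (lookup S j) (y i j)))
      ≡⟨ ℚΣ.∑-comm (λ i j → ℚΣ.when (lookup S j) (y i j)) ⟨
    ℚΣ.sum (λ i → ℚΣ.sumOver S (y i))
      ≤⟨ ℚΣ-mono-≤ (λ i → ≤-toℚ-⊓ (capacityInto u S i) (C i) (within-capacity i) (within-supply i)) ⟩
    ℚΣ.sum (λ i → toℚ (capacityInto u S i ⊓ C i))
      ≡⟨ toℚ-sum (λ i → capacityInto u S i ⊓ C i) ⟨
    toℚ (cut u C S) ∎)
    where
    open ℚ.≤-Reasoning
    within-capacity : ∀ i → ℚΣ.sumOver S (y i) ℚ.≤ toℚ (capacityInto u S i)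
    within-capacity i = ℚ.≤-trans (ℚΣ-mono-≤ (λ j → ℚwhen-mono-≤ (lookup S j) (y≤u i j)))
                                  (ℚ.≤-reflexive (sym (toℚ-sumOver S (u i))))
    within-supply : ∀ i → ℚΣ.sumOver S (y i) ℚ.≤ toℚ (C i)
    within-supply i = ℚ.≤-trans (ℚΣ-mono-≤ (λ j → ℚwhen-≤ (lookup S j) (0≤y i j))) (y≤C i)

  module Augmentation (u : Fin m → Fin n → ℕ) (C : Fin m → ℕ) (p : Fin n → ℕ)
                      (cond : CutCondition u C p) (j : Fin n) {q : ℕ} (pj≡1+q : p j ≡ suc q) where

    Tight : Subset n → Set
    Tight T = cut u C T ≤ sumOver T p × lookup T j ≡ false

    ∅-tight : Tight ∅
    ∅-tight = ≤-reflexive (trans cut∅≡0 (sym (sumOver-∅ p))) , Vec.lookup-replicate j false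
      where
      cut∅≡0 : cut u C ∅ ≡ 0
      cut∅≡0 = trans (sum-cong-≗ λ i → cong (_⊓ C i) (sumOver-∅ (u i))) (sum-replicate-zero m)

    tight-∪ : ∀ T S → Tight T → Tight S → Tight (T ∪ S)
    tight-∪ T S (cutT≤ , j∉T) (cutS≤ , j∉S) =
      +-cancelʳ-≤ (cut u C (T ∩ S)) _ _ (begin
        cut u C (T ∪ S) + cut u C (T ∩ S)      ≤⟨ cut-submodular u C T S ⟩
        cut u C T + cut u C S                  ≤⟨ +-mono-≤ cutT≤ cutS≤ ⟩
        sumOver T p + sumOver S p              ≡⟨ sumOver-∪-∩ T S p ⟨
        sumOver (T ∪ S) p + sumOver (T ∩ S) p  ≤⟨ +-monoʳ-≤ (sumOver (T ∪ S) p) (cond (T ∩ S)) ⟩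
        sumOver (T ∪ S) p + cut u C (T ∩ S)    ∎)
      , trans (Vec.lookup-zipWith _∨_ j T S) (cong₂ _∨_ j∉T j∉S)
      where open ≤-Reasoning

    Covered : Subset n → Fin m → Set
    Covered T i = C i ≤ capacityInto u T i ⊎ u i j ≡ 0 ⊎ C i ≡ 0

    covered-∪ : ∀ T S {i} → Covered T i → Covered (T ∪ S) i
    covered-∪ T S {i} (inj₁ saturated) = inj₁ (≤-trans saturated (sumOver-≤-∪ T S (u i)))
    covered-∪ T S     (inj₂ useless)   = inj₂ useless

    no-covered-tight-set : ∀ T → Tight T → (∀ i → Covered T i) → ⊥
    no-covered-tight-set T (cutT≤ , j∉T) covered = <-irrefl refl (begin-strict
      sumOver T p                ≡⟨ +-identityʳ _ ⟨
      sumOver T p + 0            <⟨ +-monoʳ-< (sumOver T p) (subst (0 <_) (sym pj≡1+q) (s≤s z≤n)) ⟩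
      sumOver T p + p j          ≡⟨ sumOver-insert T j p j∉T ⟨
      sumOver (T [ j ]≔ true) p  ≤⟨ cond (T [ j ]≔ true) ⟩
      cut u C (T [ j ]≔ true)    ≡⟨ sum-cong-≗ (λ i → trans (cong (_⊓ C i) (sumOver-insert T j (u i) j∉T))
                                                            (⊓-absorbs-+ _ _ _ (covered i))) ⟩
      cut u C T                  ≤⟨ cutT≤ ⟩
      sumOver T p                ∎)
      where open ≤-Reasoning

    u⁻ : Fin m → Fin m → Fin n → ℕ
    u⁻ i = updateAt₂ u i j ℕ.pred

    C⁻ : Fin m → Fin m → ℕ
    C⁻ i = updateAt C i ℕ.pred

    p⁻ : Fin n → ℕ
    p⁻ = updateAt p j ℕ.pred

    Routable : Fin m → Set
    Routable i = (∃[ a ] u i j ≡ suc a) × (∃[ c ] C i ≡ suc c) × CutCondition (u⁻ i) (C⁻ i) p⁻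

    violated⇒tight : ∀ i {a c} → u i j ≡ suc a → C i ≡ suc c →
                     ∀ S → ¬ sumOver S p⁻ ≤ cut (u⁻ i) (C⁻ i) S → Tight S × C i ≤ capacityInto u S i
    violated⇒tight i {a} {c} uij≡1+a Ci≡1+c S violated =
      conclude (blocking-arith (lookup S j) (sumOver-pred S p j pj≡1+q) into≡ cut≡ (cond S) (≰⇒> violated))
      where
      into≡ : capacityInto u S i ≡ when (lookup S j) 1 + capacityInto (u⁻ i) S i
      into≡ = trans (sumOver-pred S (u i) j uij≡1+a)
                    (cong (λ row → when (lookup S j) 1 + sumOver S row) (sym (updateAt-updates i u)))
      cut≡ : cut (u⁻ i) (C⁻ i) S + capacityInto u S i ⊓ suc c ≡ cut u C S + capacityInto (u⁻ i) S i ⊓ c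
      cut≡ = begin
        cut (u⁻ i) (C⁻ i) S + capacityInto u S i ⊓ suc c
          ≡⟨ cong (λ t → cut (u⁻ i) (C⁻ i) S + capacityInto u S i ⊓ t) Ci≡1+c ⟨
        cut (u⁻ i) (C⁻ i) S + capacityInto u S i ⊓ C i
          ≡⟨ sum-exchange i (λ k → capacityInto (u⁻ i) S k ⊓ C⁻ i k) (λ k → capacityInto u S k ⊓ C k) agree ⟩
        cut u C S + capacityInto (u⁻ i) S i ⊓ C⁻ i i
          ≡⟨ cong (λ t → cut u C S + capacityInto (u⁻ i) S i ⊓ t)
                  (trans (updateAt-updates i C) (cong ℕ.pred Ci≡1+c)) ⟩
        cut u C S + capacityInto (u⁻ i) S i ⊓ c ∎
        where
        open ≡-Reasoning
        agree : ∀ k → k ≢ i → capacityInto (u⁻ i) S k ⊓ C⁻ i k ≡ capacityInto u S k ⊓ C k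
        agree k k≢i = cong₂ _⊓_ (cong (sumOver S) (updateAt-minimal k i u k≢i)) (updateAt-minimal k i C k≢i)
      conclude : lookup S j ≡ false × cut u C S ≤ sumOver S p × suc c ≤ capacityInto u S i →
                 Tight S × C i ≤ capacityInto u S i
      conclude (j∉S , cut≤p , 1+c≤s) = (cut≤p , j∉S) , subst (_≤ capacityInto u S i) (sym Ci≡1+c) 1+c≤s

    routable-or-blocked : ∀ i → Routable i ⊎ ∃[ S ] Tight S × Covered S i
    routable-or-blocked i = classify (u i j) refl (C i) refl
      where
      classify : ∀ a → u i j ≡ a → ∀ c → C i ≡ c → Routable i ⊎ ∃[ S ] Tight S × Covered S i
      classify zero    uij≡0   _       _     = inj₂ (∅ , ∅-tight , inj₂ (inj₁ uij≡0))
      classify (suc a) _       zero    Ci≡0  = inj₂ (∅ , ∅-tight , inj₂ (inj₂ Ci≡0))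
      classify (suc a) uij≡1+a (suc c) Ci≡1+c
        with counterexample-or-all (λ S → sumOver S p⁻ ≤? cut (u⁻ i) (C⁻ i) S)
      ... | inj₂ holds          = inj₁ ((a , uij≡1+a) , (c , Ci≡1+c) , holds)
      ... | inj₁ (S , violated) with violated⇒tight i uij≡1+a Ci≡1+c S violated
      ...   | tight , saturated = inj₂ (S , tight , inj₁ saturated)

    routable : ∃ Routable
    routable with ∃-or-∀ routable-or-blocked
    ... | inj₁ r       = r
    ... | inj₂ blocked with union-closure ∅-tight tight-∪ covered-∪ blocked
    ...   | T , tight , covered = ⊥-elim (no-covered-tight-set T tight covered)

    augment : ∀ i {a c} → u i j ≡ suc a → C i ≡ suc c → Transport (u⁻ i) (C⁻ i) p⁻ → Transport u C p
    augment i uij≡1+a Ci≡1+c t = record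
      { flow             = updateAt₂ flow i j suc
      ; flow≤capacity    = updateAt₂-suc-≤ flow i j uij≡1+a flow≤capacity
      ; demand-met       = λ l → subst (p l ≤_) (sym (sum-updateAt₂-column flow i j l))
                                   (updateAt-pred-≤ j pj≡1+q demand-met l)
      ; supply-respected = λ k → subst (_≤ C k) (sym (sum-updateAt₂-row flow i j k))
                                   (updateAt-suc-≤ i Ci≡1+c supply-respected k)
      }
      where open Transport t

  transport : ∀ u C p → CutCondition u C p → Transport u C p
  transport u C p = go u C p (<-wellFounded (sum p))
    where
    go : ∀ u C p → Acc _<_ (sum p) → CutCondition u C p → Transport u C p
    go u C p (acc smaller) cond with sum p in sum≡
    ... | zero  = record
      { flow             = λ _ _ → 0
      ; flow≤capacity    = λ _ _ → z≤n
      ; demand-met       = λ j → ≤-reflexive (trans (sum-≡0 p sum≡ j) (sym (sum-replicate-zero m)))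
      ; supply-respected = λ i → ≤-trans (≤-reflexive (sum-replicate-zero n)) z≤n
      }
    ... | suc k with sum-suc p sum≡
    ...   | j , q , pj≡1+q with Augmentation.routable u C p cond j pj≡1+q
    ...     | i , (a , uij≡1+a) , (c , Ci≡1+c) , cond⁻ =
      augment i uij≡1+a Ci≡1+c (go (u⁻ i) (C⁻ i) p⁻ (smaller decreasing) cond⁻)
      where
      open Augmentation u C p cond j pj≡1+q
      decreasing : sum p⁻ < suc k
      decreasing = ≤-reflexive (trans (sym (sum-updateAt-pred p j pj≡1+q)) sum≡)

length-filter : ∀ {A : Set} {P : A → Set} (P? : Decidable P) xs →
                length (filter P? xs) ≡ foldr _+_ 0 (map (λ a → when (does (P? a)) 1) xs)
length-filter P? []       = refl
length-filter P? (a ∷ xs) with does (P? a)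
... | true  = cong suc (length-filter P? xs)
... | false = length-filter P? xs

does-∈? : ∀ {n} (j : Fin n) (S : Subset n) → does (j ∈? S) ≡ lookup S j
does-∈? zero    (true  ∷ S) = refl
does-∈? zero    (false ∷ S) = refl
does-∈? (suc j) (_ ∷ S)     = does-∈? j S

module _ (I : Instance) (x : Fin (Instance.m I) → ℕ) where
  open Instance I
  open Transportation {m} {n}

  allowed : Fin m → Fin n → Bool
  allowed i j = does (K j ∈ˡ? Anc tree i)

  count : Subset n → Fin m → ℕ
  count J′ i = sumOver J′ (λ j → when (allowed i j) 1)

  capacity : Fin m → Fin n → ℕ
  capacity i j = when (allowed i j) (x i)

  slots : Fin m → ℕ
  slots i = g * x i

  countAnc-≡ : ∀ J′ i → countAnc I J′ i ≡ count J′ i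
  countAnc-≡ J′ i =
    trans (length-filter _ (allFin n)) (trans (foldr-map-allFin (λ j → when (does (j ∈? J′) ∧ allowed i j) 1))
      (sum-cong-≗ λ j → trans (cong (λ b → when (b ∧ allowed i j) 1) (does-∈? j J′)) (when-∧ (lookup J′ j) _ 1)))

  pSum-≡ : ∀ J′ → pSum I J′ ≡ sumOver J′ p
  pSum-≡ J′ =
    trans (foldr-map-filter _ p (allFin n)) (trans (foldr-map-allFin (λ j → when (does (j ∈? J′)) (p j)))
      (sum-cong-≗ λ j → cong (λ b → when b (p j)) (does-∈? j J′)))

  lhs-≡ : ∀ J′ → lhs I x J′ ≡ sum (λ i → (count J′ i ⊓ g) * x i)
  lhs-≡ J′ = trans (foldr-map-allFin (λ i → (countAnc I J′ i ⊓ g) * x i))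
                   (sum-cong-≗ λ i → cong (λ c → (c ⊓ g) * x i) (countAnc-≡ J′ i))

  xSmall-≡ : ∀ J′ j → xSmall I x J′ j ≡ sum (λ i → when (allowed i j ∧ does (count J′ i ≤? g)) (x i))
  xSmall-≡ J′ j =
    trans (foldr-map-filter _ x (allFin m))
      (trans (foldr-map-allFin (λ i → when (allowed i j ∧ does (countAnc I J′ i ≤? g)) (x i)))
        (sum-cong-≗ λ i → cong (λ c → when (allowed i j ∧ does (c ≤? g)) (x i)) (countAnc-≡ J′ i)))

  capacityInto-≡ : ∀ S i → capacityInto capacity S i ≡ count S i * x i
  capacityInto-≡ S i = trans (sum-cong-≗ λ j → when-when-* (lookup S j) (allowed i j) (x i))
                             (sym (*-distribʳ-sum (x i) (λ j → when (lookup S j) (when (allowed i j) 1))))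

  ineq⇔cut-condition : ∀ J′ → Ineq I x J′ ⇔ (sumOver J′ p ≤ cut capacity slots J′)
  ineq⇔cut-condition J′ =
    mk⇔ (subst₂ _≤_ (pSum-≡ J′) lhs≡cut) (subst₂ _≤_ (sym (pSum-≡ J′)) (sym lhs≡cut))
    where
    lhs≡cut : lhs I x J′ ≡ cut capacity slots J′
    lhs≡cut = trans (lhs-≡ J′) (sum-cong-≗ λ i →
      trans (*-distribʳ-⊓ (x i) (count J′ i) g) (cong (_⊓ slots i) (sym (capacityInto-≡ J′ i))))

  drop-violator : ∀ J′ j → lookup J′ j ≡ true → p j ≤ xSmall I x J′ j →
                  Ineq I x (J′ [ j ]≔ false) → Ineq I x J′
  drop-violator J′ j j∈J′ pj≤small ineq⁻ = begin
    pSum I J′                      ≡⟨ pSum-≡ J′ ⟩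
    sumOver J′ p                   ≡⟨ sumOver-remove J′ j p j∈J′ ⟩
    p j + sumOver J⁻ p             ≤⟨ +-mono-≤ pj≤small (≤-trans (≤-reflexive (sym (pSum-≡ J⁻))) ineq⁻) ⟩
    xSmall I x J′ j + lhs I x J⁻   ≡⟨ cong₂ _+_ (xSmall-≡ J′ j) (lhs-≡ J⁻) ⟩
    sum small + sum (λ i → (count J⁻ i ⊓ g) * x i)
      ≡⟨ ∑-distrib-+ small (λ i → (count J⁻ i ⊓ g) * x i) ⟨
    sum (λ i → small i + (count J⁻ i ⊓ g) * x i)
      ≤⟨ sum-mono-≤ (λ i → ⊓-increment g (allowed i j) (x i)
                             (sumOver-remove J′ j (λ j → when (allowed i j) 1) j∈J′)) ⟩
    sum (λ i → (count J′ i ⊓ g) * x i)  ≡⟨ lhs-≡ J′ ⟨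
    lhs I x J′                          ∎
    where
    open ≤-Reasoning
    J⁻ : Subset n
    J⁻ = J′ [ j ]≔ false
    small : Fin m → ℕ
    small i = when (allowed i j ∧ does (count J′ i ≤? g)) (x i)

  property-suffices : (∀ J′ → Property I x J′ → Ineq I x J′) → ∀ J′ → Ineq I x J′
  property-suffices hyp = removal-induction (Ineq I x) λ J′ → reduce J′ (∃-or-∀ (classify J′))
    where
    classify : ∀ J′ j → (j ∈ J′ × p j ≤ xSmall I x J′ j) ⊎ (j ∈ J′ → xSmall I x J′ j < p j)
    classify J′ j with j ∈? J′ | xSmall I x J′ j ℕ.<? p j
    ... | no j∉J′  | _           = inj₂ (λ j∈J′ → contradiction j∈J′ j∉J′)
    ... | yes _    | yes small<p = inj₂ (λ _ → small<p)
    ... | yes j∈J′ | no small≮p  = inj₁ (j∈J′ , ≮⇒≥ small≮p)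
    reduce : ∀ J′ → ∃[ j ] (j ∈ J′ × p j ≤ xSmall I x J′ j) ⊎ Property I x J′ →
             Ineq I x J′ ⊎ ∃[ j ] lookup J′ j ≡ true × (Ineq I x (J′ [ j ]≔ false) → Ineq I x J′)
    reduce J′ (inj₂ property)               = inj₁ (hyp J′ property)
    reduce J′ (inj₁ (j , j∈J′ , pj≤small)) =
      inj₂ (j , Vec.[]=⇒lookup j∈J′ , drop-violator J′ j (Vec.[]=⇒lookup j∈J′) pj≤small)

  Σℚ-column : ∀ j (f : Fin m → ℚ) → Σℚ I (map f (filter (λ i → K j ∈ˡ? Anc tree i) (allFin m)))
                                    ≡ ℚΣ.sum (λ i → ℚΣ.when (allowed i j) (f i))
  Σℚ-column j f = trans (ℚΣ.foldr-map-filter _ f (allFin m))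
                        (ℚΣ.foldr-map-allFin (λ i → ℚΣ.when (allowed i j) (f i)))

  Σℚ-row : ∀ i (f : Fin n → ℚ) → Σℚ I (map f (filter (λ j → K j ∈ˡ? Anc tree i) (allFin n)))
                                 ≡ ℚΣ.sum (λ j → ℚΣ.when (allowed i j) (f j))
  Σℚ-row i f = trans (ℚΣ.foldr-map-filter _ f (allFin n))
                     (ℚΣ.foldr-map-allFin (λ j → ℚΣ.when (allowed i j) (f j)))

  feasible⇒ineq : Feasible I x → ∀ J′ → Ineq I x J′
  feasible⇒ineq (y , 0≤y , y≤x , demand , y≤slots) J′ = Equivalence.from (ineq⇔cut-condition J′)
    (fractional-transport⇒cut-condition capacity slots p (λ i j → ℚΣ.when (allowed i j) (y i j))
      (λ i j → proj₁ (bounds i j (K j ∈ˡ? Anc tree i))) (λ i j → proj₂ (bounds i j (K j ∈ˡ? Anc tree i)))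
      (λ j → subst (toℚ (p j) ℚ.≤_) (Σℚ-column j (λ i → y i j)) (demand j))
      (λ i → subst (ℚ._≤ toℚ (slots i)) (Σℚ-row i (y i)) (y≤slots i)) J′)
    where
    bounds : ∀ i j (d : Dec (K j ∈ˡ Anc tree i)) →
             0ℚ ℚ.≤ ℚΣ.when (does d) (y i j) × ℚΣ.when (does d) (y i j) ℚ.≤ toℚ (when (does d) (x i))
    bounds i j (yes K[j]∈Anc[i]) = 0≤y i j K[j]∈Anc[i] , y≤x i j K[j]∈Anc[i]
    bounds i j (no _)            = ℚ.≤-refl , ℚ.≤-refl

  ineq⇒feasible : (∀ J′ → Ineq I x J′) → Feasible I x
  ineq⇒feasible ineq =
    y , (λ i j _ → toℚ-mono-≤ {b = flow i j} z≤n) ,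
    (λ i j K[j]∈Anc[i] → toℚ-mono-≤ (flow≤x i j K[j]∈Anc[i])) ,
    (λ j → subst (toℚ (p j) ℚ.≤_) (sym column-sum) (toℚ-mono-≤ (demand-met j))) ,
    (λ i → subst (ℚ._≤ toℚ (slots i)) (sym row-sum) (toℚ-mono-≤ (supply-respected i)))
    where
    open Transport (transport capacity slots p λ J′ → Equivalence.to (ineq⇔cut-condition J′) (ineq J′))
    y : Fin m → Fin n → ℚ
    y i j = toℚ (flow i j)
    flow≤x : ∀ i j → K j ∈ˡ Anc tree i → flow i j ≤ x i
    flow≤x i j K[j]∈Anc[i] =
      subst (λ b → flow i j ≤ when b (x i)) (dec-true (K j ∈ˡ? Anc tree i) K[j]∈Anc[i]) (flow≤capacity i j)
    unrestricted : ∀ i j → ℚΣ.when (allowed i j) (y i j) ≡ y i j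
    unrestricted i j = trans (sym (toℚ-when (allowed i j) (flow i j)))
                             (cong toℚ (when-fixes (allowed i j) (flow≤capacity i j)))
    column-sum : ∀ {j} → Σℚ I (map (λ i → y i j) (filter (λ i → K j ∈ˡ? Anc tree i) (allFin m)))
                         ≡ toℚ (sum (λ i → flow i j))
    column-sum {j} = trans (Σℚ-column j (λ i → y i j))
                           (trans (ℚΣ.sum-cong-≗ (λ i → unrestricted i j)) (sym (toℚ-sum (λ i → flow i j))))
    row-sum : ∀ {i} → Σℚ I (map (y i) (filter (λ j → K j ∈ˡ? Anc tree i) (allFin n))) ≡ toℚ (sum (flow i))
    row-sum {i} = trans (Σℚ-row i (y i)) (trans (ℚΣ.sum-cong-≗ (unrestricted i)) (sym (toℚ-sum (flow i))))

lemma3 : (I : Instance) → (x : Fin (Instance.m I) → ℕ)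
    → ((∀ (J' : Subset (Instance.n I)) → Property I x J' → Ineq I x J')
    → ∀ (J' : Subset (Instance.n I)) → Ineq I x J')
    × (Feasible I x ⇔ (∀ (J' : Subset (Instance.n I)) → Property I x J' → Ineq I x J'))
lemma3 I x = property-suffices I x ,
             mk⇔ (λ feasible J′ _ → feasible⇒ineq I x feasible J′)
                 (λ suffices → ineq⇒feasible I x (property-suffices I x suffices))
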